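{- Let $\mathcal{H}=(\mathcal{C},A_{\mathcal{C}})$ be a directed acyclic graph (the color hierarchy graph of an instance of Maximum Colorful Arborescence), and let $X\subseteq\mathcal{C}$ be the set of vertices of $\mathcal{H}$ of indegree at least $2$. For any arborescence $T$ contained in $\mathcal{H}$, let $X(T)$ denote the set of vertices of $T$ that belong to $X$. Then for any $c\in\mathcal{C}$, any pair of distinct vertices $c_1,c_2\in N^+(c)$ (out-neighbors of $c$ in $\mathcal{H}$), and any disjoint sets $X_1,X_2\subseteq X$, every arborescence $T_1$ in $\mathcal{H}$ rooted in $c_1$ with $X(T_1)\subseteq X_1$ is vertex-disjoint from every arborescence $T_2$ in $\mathcal{H}$ rooted in $c_2$ with $X(T_2)\subseteq X_2$.
   Context: An arborescence rooted in $v$ is a subgraph that is a directed tree in which every vertex is reachable from $v$ by a directed path (all arcs directed away from $v$). The vertices of $X$ are called difficult colors. -}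

module Defs where

open import Data.Nat using (ℕ)
open import Data.Fin using (Fin)
open import Data.Product using (Σ; _×_; ∃)
open import Data.Empty using (⊥)
open import Relation.Nullary using (¬_)
open import Relation.Binary.PropositionalEquality using (_≡_; _≢_)
open import Relation.Binary.Construct.Closure.ReflexiveTransitive using (Star)

record Digraph (n : ℕ) : Set₁ where
  field
    Arc : Fin n → Fin n → Set

open Digraph public

Acyclic : ∀ {n} → Digraph n → Set
Acyclic H = ∀ u v → Arc H u v → ¬ Star (Arc H) v u

OutNbr : ∀ {n} → Digraph n → Fin n → Fin n → Set
OutNbr H c d = Arc H c d

Difficult : ∀ {n} → Digraph n → Fin n → Set
Difficult H v = Σ _ λ a → Σ _ λ b → a ≢ b × Arc H a v × Arc H b v

record Subgraph {n : ℕ} (H : Digraph n) : Set₁ where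
  field
    V : Fin n → Set
    E : Fin n → Fin n → Set
    E⊆A : ∀ u v → E u v → Arc H u v
    E-src : ∀ u v → E u v → V u
    E-tgt : ∀ u v → E u v → V v

open Subgraph public

record IsArborescence {n : ℕ} {H : Digraph n} (T : Subgraph H) (r : Fin n) : Set where
  field
    root∈ : V T r
    root-no-in : ∀ u → ¬ E T u r
    unique-in : ∀ v → V T v → v ≢ r →
                Σ (Fin n) λ u → E T u v × (∀ w → E T w v → w ≡ u)
    reachable : ∀ v → V T v → Star (E T) r v

-- X(T) ⊆ Y : every difficult vertex of T lies in Y.
DiffIn : ∀ {n} {H : Digraph n} → Subgraph H → (Fin n → Set) → Set
DiffIn {H = H} T Y = ∀ v → V T v → Difficult H v → Y v

-- A vertex shared by T₁ and T₂ has the same parent in both, counting c as the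
-- parent of the roots c₁ and c₂: two distinct H-arcs into it would make it
-- difficult, hence in X₁ ∩ X₂.  Walking back along the T₁-path from a shared
-- vertex to c₁ thus stays in T₂, and the parent of c₁ in T₂ must be c.  But by
-- acyclicity c lies in no arborescence rooted at one of its out-neighbours.
module Submission where

open import Defs
open import Data.Nat using (ℕ)
open import Data.Fin using (Fin; _≟_)
open import Data.Empty using (⊥; ⊥-elim)
open import Data.Product using (_,_)
open import Relation.Nullary using (¬_; yes; no)
open import Relation.Binary.PropositionalEquality using (_≡_; _≢_; refl; subst)
open import Relation.Binary.Construct.Closure.ReflexiveTransitive using (Star; ε; _◅_)
import Relation.Binary.Construct.Closure.ReflexiveTransitive as Star

module _ {n : ℕ} {H : Digraph n} where

  star-E⇒star-Arc : (T : Subgraph H) → ∀ {x y} → Star (E T) x y → Star (Arc H) x y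
  star-E⇒star-Arc T = Star.map (λ {x} {y} → E⊆A T x y)

  in-neighbour∉arborescence : Acyclic H → (T : Subgraph H) → ∀ {r c} →
                              IsArborescence T r → Arc H c r → ¬ V T c
  in-neighbour∉arborescence acyclic T {r} {c} A c→r c∈T =
    acyclic c r c→r (star-E⇒star-Arc T (IsArborescence.reachable A c c∈T))

  NoSharedDifficult : Subgraph H → Subgraph H → Set
  NoSharedDifficult T₁ T₂ = ∀ w → V T₁ w → V T₂ w → ¬ Difficult H w

  shared-in-neighbours-equal : (T₁ T₂ : Subgraph H) → NoSharedDifficult T₁ T₂ →
                               ∀ {w a b} → V T₁ w → V T₂ w →
                               Arc H a w → Arc H b w → a ≡ b
  shared-in-neighbours-equal T₁ T₂ noShared {w} {a} {b} w∈T₁ w∈T₂ a→w b→w with a ≟ b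
  ... | yes a≡b = a≡b
  ... | no  a≢b = ⊥-elim (noShared w w∈T₁ w∈T₂ (a , b , a≢b , a→w , b→w))

  module _ (acyclic : Acyclic H) {c r₁ r₂ : Fin n} (T₁ T₂ : Subgraph H)
           (A₁ : IsArborescence T₁ r₁) (A₂ : IsArborescence T₂ r₂)
           (c→r₁ : Arc H c r₁) (c→r₂ : Arc H c r₂)
           (noShared : NoSharedDifficult T₁ T₂) where

    parent-shared : ∀ {x y} → E T₁ x y → V T₂ y → V T₂ x
    parent-shared {x} {y} x→y y∈T₂ with y ≟ r₂
    ... | yes refl = ⊥-elim (in-neighbour∉arborescence acyclic T₁ A₁ c→r₁ c∈T₁)
      where
      c∈T₁ : V T₁ c
      c∈T₁ = subst (V T₁)
        (shared-in-neighbours-equal T₁ T₂ noShared (E-tgt T₁ x y x→y) y∈T₂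
                                    (E⊆A T₁ x y x→y) c→r₂)
        (E-src T₁ x y x→y)
    ... | no y≢r₂ with IsArborescence.unique-in A₂ y y∈T₂ y≢r₂
    ...   | u , u→y , _ =
      subst (V T₂)
        (shared-in-neighbours-equal T₁ T₂ noShared (E-tgt T₁ x y x→y) y∈T₂
                                    (E⊆A T₂ u y u→y) (E⊆A T₁ x y x→y))
        (E-src T₂ u y u→y)

    path-shared : ∀ {x v} → Star (E T₁) x v → V T₂ v → V T₂ x
    path-shared ε           v∈T₂ = v∈T₂
    path-shared (x→y ◅ y⇝v) v∈T₂ = parent-shared x→y (path-shared y⇝v v∈T₂)

    root₁-unshared : r₁ ≢ r₂ → ¬ V T₂ r₁
    root₁-unshared r₁≢r₂ r₁∈T₂ with IsArborescence.unique-in A₂ r₁ r₁∈T₂ r₁≢r₂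
    ... | u , u→r₁ , _ =
      in-neighbour∉arborescence acyclic T₂ A₂ c→r₂
        (subst (V T₂)
          (shared-in-neighbours-equal T₁ T₂ noShared (IsArborescence.root∈ A₁) r₁∈T₂
                                      (E⊆A T₂ u r₁ u→r₁) c→r₁)
          (E-src T₂ u r₁ u→r₁))

    sibling-arborescences-disjoint : r₁ ≢ r₂ → ∀ v → V T₁ v → V T₂ v → ⊥
    sibling-arborescences-disjoint r₁≢r₂ v v∈T₁ v∈T₂ =
      root₁-unshared r₁≢r₂ (path-shared (IsArborescence.reachable A₁ v v∈T₁) v∈T₂)

lemma2p1 : ∀ (n : ℕ) (H : Digraph n) → Acyclic H →
           ∀ (c c₁ c₂ : Fin n) → OutNbr H c c₁ → OutNbr H c c₂ → c₁ ≢ c₂ →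
           ∀ (X₁ X₂ : Fin n → Set) →
           (∀ v → X₁ v → Difficult H v) → (∀ v → X₂ v → Difficult H v) →
           (∀ v → X₁ v → X₂ v → ⊥) →
           ∀ (T₁ T₂ : Subgraph H) →
           IsArborescence T₁ c₁ → DiffIn T₁ X₁ →
           IsArborescence T₂ c₂ → DiffIn T₂ X₂ →
           ∀ v → V T₁ v → V T₂ v → ⊥
lemma2p1 n H acyclic c c₁ c₂ c→c₁ c→c₂ c₁≢c₂ X₁ X₂ _ _ X₁∩X₂=∅ T₁ T₂ A₁ X[T₁]⊆X₁ A₂ X[T₂]⊆X₂ =
  sibling-arborescences-disjoint acyclic T₁ T₂ A₁ A₂ c→c₁ c→c₂ noShared c₁≢c₂
  where
  noShared : NoSharedDifficult T₁ T₂
  noShared w w∈T₁ w∈T₂ w-difficult =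
    X₁∩X₂=∅ w (X[T₁]⊆X₁ w w∈T₁ w-difficult) (X[T₂]⊆X₂ w w∈T₂ w-difficult)
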